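{- Let $R$ be a commutative ring and $I\subseteq R$ an ideal with $I^2=0$. Then the kernel of the natural reduction homomorphism $\mathrm{Aut}(\mathbb{A}^1_R)\to\mathrm{Aut}(\mathbb{A}^1_{R/I})$ is abelian.
   Context: For a commutative ring $B$, $\mathrm{Aut}(\mathbb{A}^1_B)$ denotes the group of polynomials $f\in B[T]$ invertible under composition, with group law composition; the reduction map sends a polynomial to its image with coefficients reduced modulo $I$. -}

module Defs where

open import Level using (Level; _⊔_) renaming (suc to lsuc)
open import Algebra.Bundles using (CommutativeRing)
open import Algebra.Structures using (IsCommutativeRing)
open import Data.List using (List; []; _∷_; map)
open import Data.Nat using (ℕ; zero; suc)
open import Data.Product using (Σ; _×_; _,_)
open import Relation.Binary.Structures using (IsEquivalence)
import Relation.Binary.Reasoning.Setoid as SetoidReasoning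
import Algebra.Properties.Ring as RingProps

private
  variable
    c ℓ ℓ' : Level

record Ideal (R : CommutativeRing c ℓ) (ℓ' : Level) : Set (c ⊔ ℓ ⊔ lsuc ℓ') where
  open CommutativeRing R
  field
    member : Carrier → Set ℓ'
    member-resp : ∀ {a b} → a ≈ b → member a → member b
    0∈ : member 0#
    +∈ : ∀ {a b} → member a → member b → member (a + b)
    -∈ : ∀ {a} → member a → member (- a)
    *∈ : ∀ r {a} → member a → member (r * a)

-- I² = 0 : the ideal I² is generated by the products a*b with a,b ∈ I,
-- so I² = 0 means exactly that all such products vanish.
SquareZero : (R : CommutativeRing c ℓ) → Ideal R ℓ' → Set _
SquareZero R I = ∀ a b → member a → member b → a * b ≈ 0#
  where open CommutativeRing R
        open Ideal I

module _ (R : CommutativeRing c ℓ) (I : Ideal R ℓ') where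
  private
    open CommutativeRing R
    open Ideal I
    open RingProps ring
    open SetoidReasoning setoid

    _~_ : Carrier → Carrier → Set ℓ'
    a ~ b = member (a - b)

    ≈⇒~ : ∀ {a b} → a ≈ b → a ~ b
    ≈⇒~ {a} {b} a≈b = member-resp (sym (begin
      a - b ≈⟨ +-congʳ a≈b ⟩
      b - b ≈⟨ -‿inverseʳ b ⟩
      0# ∎)) 0∈

    ~-sym : ∀ {a b} → a ~ b → b ~ a
    ~-sym {a} {b} p = member-resp (begin
      - (a - b) ≈⟨ sym (-‿+-comm a (- b)) ⟩
      - a + - - b ≈⟨ +-congˡ (-‿involutive b) ⟩
      - a + b ≈⟨ +-comm (- a) b ⟩
      b - a ∎) (-∈ p)

    ~-trans : ∀ {a b d} → a ~ b → b ~ d → a ~ d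
    ~-trans {a} {b} {d} p q = member-resp (begin
      (a - b) + (b - d) ≈⟨ +-assoc a (- b) (b - d) ⟩
      a + (- b + (b - d)) ≈⟨ +-congˡ (sym (+-assoc (- b) b (- d))) ⟩
      a + ((- b + b) - d) ≈⟨ +-congˡ (+-congʳ (-‿inverseˡ b)) ⟩
      a + (0# - d) ≈⟨ +-congˡ (+-identityˡ (- d)) ⟩
      a - d ∎) (+∈ p q)

    +-cong~ : ∀ {x y u v} → x ~ y → u ~ v → (x + u) ~ (y + v)
    +-cong~ {x} {y} {u} {v} p q = member-resp (begin
      (x - y) + (u - v) ≈⟨ +-assoc x (- y) (u - v) ⟩
      x + (- y + (u - v)) ≈⟨ +-congˡ (sym (+-assoc (- y) u (- v))) ⟩
      x + ((- y + u) - v) ≈⟨ +-congˡ (+-congʳ (+-comm (- y) u)) ⟩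
      x + ((u - y) - v) ≈⟨ +-congˡ (+-assoc u (- y) (- v)) ⟩
      x + (u + (- y - v)) ≈⟨ sym (+-assoc x u (- y - v)) ⟩
      (x + u) + (- y - v) ≈⟨ +-congˡ (-‿+-comm y v) ⟩
      (x + u) - (y + v) ∎) (+∈ p q)

    -‿cong~ : ∀ {x y} → x ~ y → (- x) ~ (- y)
    -‿cong~ {x} {y} p = member-resp (sym (-‿+-comm x (- y))) (-∈ p)

    *-cong~ : ∀ {x y u v} → x ~ y → u ~ v → (x * u) ~ (y * v)
    *-cong~ {x} {y} {u} {v} p q = member-resp (begin
      u * (x - y) + y * (u - v)
        ≈⟨ +-cong (distribˡ u x (- y)) (distribˡ y u (- v)) ⟩
      (u * x + u * - y) + (y * u + y * - v)
        ≈⟨ +-cong (+-cong (*-comm u x) (sym (-‿distribʳ-* u y)))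
                  (+-congˡ (sym (-‿distribʳ-* y v))) ⟩
      (x * u - u * y) + (y * u - y * v)
        ≈⟨ +-congʳ (+-congˡ (-‿cong (*-comm u y))) ⟩
      (x * u - y * u) + (y * u - y * v)
        ≈⟨ +-assoc (x * u) (- (y * u)) (y * u - y * v) ⟩
      x * u + (- (y * u) + (y * u - y * v))
        ≈⟨ +-congˡ (sym (+-assoc (- (y * u)) (y * u) (- (y * v)))) ⟩
      x * u + ((- (y * u) + y * u) - y * v)
        ≈⟨ +-congˡ (+-congʳ (-‿inverseˡ (y * u))) ⟩
      x * u + (0# - y * v)
        ≈⟨ +-congˡ (+-identityˡ (- (y * v))) ⟩
      x * u - y * v ∎) (+∈ (*∈ u p) (*∈ y q))

    quotIsCR : IsCommutativeRing _~_ _+_ _*_ -_ 0# 1#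
    quotIsCR = record
      { isRing = record
        { +-isAbelianGroup = record
          { isGroup = record
            { isMonoid = record
              { isSemigroup = record
                { isMagma = record
                  { isEquivalence = record
                    { refl = ≈⇒~ refl ; sym = ~-sym ; trans = ~-trans }
                  ; ∙-cong = +-cong~ }
                ; assoc = λ x y z → ≈⇒~ (+-assoc x y z) }
              ; identity = (λ x → ≈⇒~ (+-identityˡ x)) , (λ x → ≈⇒~ (+-identityʳ x)) }
            ; inverse = (λ x → ≈⇒~ (-‿inverseˡ x)) , (λ x → ≈⇒~ (-‿inverseʳ x))
            ; ⁻¹-cong = -‿cong~ }
          ; comm = λ x y → ≈⇒~ (+-comm x y) }
        ; *-cong = *-cong~
        ; *-assoc = λ x y z → ≈⇒~ (*-assoc x y z)
        ; *-identity = (λ x → ≈⇒~ (*-identityˡ x)) , (λ x → ≈⇒~ (*-identityʳ x))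
        ; distrib = (λ x y z → ≈⇒~ (distribˡ x y z)) , (λ x y z → ≈⇒~ (distribʳ x y z)) }
      ; *-comm = λ x y → ≈⇒~ (*-comm x y) }

  _/_ : CommutativeRing c ℓ'
  _/_ = record { isCommutativeRing = quotIsCR }

-- Polynomials B[T] over a commutative ring B, as coefficient lists
-- (constant term first), with equality "all coefficients equal".

module _ (B : CommutativeRing c ℓ) where
  open CommutativeRing B

  Poly : Set c
  Poly = List Carrier

  coeff : Poly → ℕ → Carrier
  coeff []      _       = 0#
  coeff (a ∷ p) zero    = a
  coeff (a ∷ p) (suc n) = coeff p n

  _≈P_ : Poly → Poly → Set ℓ
  p ≈P q = ∀ n → coeff p n ≈ coeff q n

  _+P_ : Poly → Poly → Poly
  []      +P q       = q
  (a ∷ p) +P []      = a ∷ p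
  (a ∷ p) +P (b ∷ q) = (a + b) ∷ (p +P q)

  _·P_ : Carrier → Poly → Poly
  a ·P p = map (a *_) p

  _*P_ : Poly → Poly → Poly
  []      *P q = []
  (a ∷ p) *P q = (a ·P q) +P (0# ∷ (p *P q))

  _∘P_ : Poly → Poly → Poly
  []      ∘P g = []
  (a ∷ p) ∘P g = (a ∷ []) +P (g *P (p ∘P g))

  T : Poly
  T = 0# ∷ 1# ∷ []

  IsAut : Poly → Set (c ⊔ ℓ)
  IsAut f = Σ Poly λ g → (f ∘P g) ≈P T × (g ∘P f) ≈P T

-- Reduction modulo I:  B[T] → (B/I)[T]  (reduce each coefficient; since
-- R/I has the same carrier as R, this is the identity on coefficient lists).

module _ (R : CommutativeRing c ℓ) (I : Ideal R ℓ') where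

  reduce : Poly R → Poly (R / I)
  reduce f = f

  InKernel : Poly R → Set (c ⊔ ℓ ⊔ ℓ')
  InKernel f = IsAut R f × _≈P_ (R / I) (reduce f) (T (R / I))

module Submission where

-- Write an element of the kernel as g = X + b with b ∈ I[X].  For any
-- polynomial f, Horner's rule f = f₀ + X·f' (f' = tail f) gives
--   f(g) = f₀ + g·f'(g) = f₀ + X·f'(g) + b·f'(g).
-- If the tail of q lies in I[X], then b·(tail q) = 0 because I² = 0, and
-- induction on q shows q(g) = q.  For f in the kernel, f' ≡ 1 mod I, so
-- its own tail lies in I[X]; hence f'(g) = f' and b·f' = b·1 = b (again
-- because I·I = 0).  Therefore  f ∘ g = f + b = f + g − X,  an expression
-- symmetric in f and g, and so f ∘ g = g ∘ f.

open import Defs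
open import Level using (Level)
open import Algebra.Bundles using (CommutativeRing)
open import Data.List using ([]; _∷_; map)
open import Data.Nat using (ℕ; zero; suc)
open import Data.Product using (proj₂)
open import Relation.Binary.Bundles using (Setoid)
open import Relation.Binary.PropositionalEquality as ≡ using (_≡_; subst₂)
import Algebra.Properties.Ring as RingProperties
import Algebra.Properties.CommutativeSemigroup as CommutativeSemigroupProperties
import Relation.Binary.Reasoning.Setoid as SetoidReasoning

module PolynomialArithmetic {c ℓ : Level} (R : CommutativeRing c ℓ) where
  open CommutativeRing R hiding (zero)
  open RingProperties ring using (-0#≈0#)
  open CommutativeSemigroupProperties +-commutativeSemigroup using (interchange)

  P : Set c
  P = Poly R

  infix  10 _[_]
  infixl 7  _⊗_
  infixr 7  _·_
  infixl 6  _⊕_ _⊖_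
  infix  4  _≋_

  _[_] : P → ℕ → Carrier
  p [ n ] = coeff R p n

  -- Coefficientwise equality, i.e. Defs' _≈P_, packaged as a record so
  -- that the two polynomials can be inferred from a proof.
  record _≋_ (p q : P) : Set ℓ where
    constructor coeffwise
    field at : ∀ n → p [ n ] ≈ q [ n ]
  open _≋_ public

  _⊕_ : P → P → P
  _⊕_ = _+P_ R

  _·_ : Carrier → P → P
  _·_ = _·P_ R

  _⊗_ : P → P → P
  _⊗_ = _*P_ R

  _∘ₚ_ : P → P → P
  _∘ₚ_ = _∘P_ R

  X : P
  X = T R

  _⊖_ : P → P → P
  p ⊖ q = p ⊕ map -_ q

  tail : P → P
  tail []      = []
  tail (_ ∷ p) = p

  coeff-tail : ∀ p n → tail p [ n ] ≡ p [ suc n ]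
  coeff-tail []      n = ≡.refl
  coeff-tail (_ ∷ p) n = ≡.refl

  coeff-⊕ : ∀ p q n → (p ⊕ q) [ n ] ≈ p [ n ] + q [ n ]
  coeff-⊕ []      q       n       = sym (+-identityˡ _)
  coeff-⊕ (a ∷ p) []      n       = sym (+-identityʳ _)
  coeff-⊕ (a ∷ p) (b ∷ q) zero    = refl
  coeff-⊕ (a ∷ p) (b ∷ q) (suc n) = coeff-⊕ p q n

  coeff-· : ∀ a p n → (a · p) [ n ] ≈ a * p [ n ]
  coeff-· a []      n       = sym (zeroʳ a)
  coeff-· a (x ∷ p) zero    = refl
  coeff-· a (x ∷ p) (suc n) = coeff-· a p n

  coeff-neg : ∀ p n → map -_ p [ n ] ≈ - p [ n ]
  coeff-neg []      n       = sym -0#≈0#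
  coeff-neg (x ∷ p) zero    = refl
  coeff-neg (x ∷ p) (suc n) = coeff-neg p n

  coeff-⊖ : ∀ p q n → (p ⊖ q) [ n ] ≈ p [ n ] - q [ n ]
  coeff-⊖ p q n = trans (coeff-⊕ p (map -_ q) n) (+-congˡ (coeff-neg q n))

  coeff-∷⊗ : ∀ a p q n → ((a ∷ p) ⊗ q) [ n ] ≈ a * q [ n ] + (0# ∷ p ⊗ q) [ n ]
  coeff-∷⊗ a p q n = trans (coeff-⊕ (a · q) (0# ∷ p ⊗ q) n) (+-congʳ (coeff-· a q n))

  ≋-setoid : Setoid c ℓ
  ≋-setoid = record
    { Carrier = P
    ; _≈_ = _≋_
    ; isEquivalence = record
      { refl  = coeffwise (λ _ → refl)
      ; sym   = λ p≋q → coeffwise (λ n → sym (at p≋q n))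
      ; trans = λ p≋q q≋r → coeffwise (λ n → trans (at p≋q n) (at q≋r n)) } }

  open Setoid ≋-setoid public
    using () renaming (refl to ≋-refl; sym to ≋-sym; trans to ≋-trans)

  ∷-cong : ∀ {a b p q} → a ≈ b → p ≋ q → a ∷ p ≋ b ∷ q
  ∷-cong a≈b p≋q = coeffwise λ { zero → a≈b ; (suc n) → at p≋q n }

  ∷-congˡ : ∀ {a b} p → a ≈ b → a ∷ p ≋ b ∷ p
  ∷-congˡ p a≈b = ∷-cong a≈b ≋-refl

  ∷-zero : ∀ {p} → p ≋ [] → 0# ∷ p ≋ []
  ∷-zero p≋0 = coeffwise λ { zero → refl ; (suc n) → at p≋0 n }

  ⊕-cong : ∀ {p p' q q'} → p ≋ p' → q ≋ q' → p ⊕ q ≋ p' ⊕ q'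
  ⊕-cong {p} {p'} {q} {q'} p≋p' q≋q' = coeffwise λ n → begin
    (p ⊕ q) [ n ]        ≈⟨ coeff-⊕ p q n ⟩
    p [ n ] + q [ n ]    ≈⟨ +-cong (at p≋p' n) (at q≋q' n) ⟩
    p' [ n ] + q' [ n ]  ≈⟨ coeff-⊕ p' q' n ⟨
    (p' ⊕ q') [ n ]      ∎
    where open SetoidReasoning setoid

  ⊕-congˡ : ∀ p {q q'} → q ≋ q' → p ⊕ q ≋ p ⊕ q'
  ⊕-congˡ p = ⊕-cong (≋-refl {p})

  ⊕-congʳ : ∀ {p p'} q → p ≋ p' → p ⊕ q ≋ p' ⊕ q
  ⊕-congʳ q p≋p' = ⊕-cong p≋p' (≋-refl {q})

  ⊕-identityʳ : ∀ p → p ⊕ [] ≋ p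
  ⊕-identityʳ p = coeffwise λ n → trans (coeff-⊕ p [] n) (+-identityʳ _)

  ⊕-assoc : ∀ p q r → p ⊕ q ⊕ r ≋ p ⊕ (q ⊕ r)
  ⊕-assoc p q r = coeffwise λ n → begin
    (p ⊕ q ⊕ r) [ n ]              ≈⟨ trans (coeff-⊕ (p ⊕ q) r n) (+-congʳ (coeff-⊕ p q n)) ⟩
    p [ n ] + q [ n ] + r [ n ]    ≈⟨ +-assoc _ _ _ ⟩
    p [ n ] + (q [ n ] + r [ n ])  ≈⟨ trans (coeff-⊕ p (q ⊕ r) n) (+-congˡ (coeff-⊕ q r n)) ⟨
    (p ⊕ (q ⊕ r)) [ n ]            ∎
    where open SetoidReasoning setoid

  ∷-⊕ : ∀ p q → 0# ∷ (p ⊕ q) ≋ (0# ∷ p) ⊕ (0# ∷ q)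
  ∷-⊕ p q = ∷-congˡ (p ⊕ q) (sym (+-identityʳ 0#))

  ·-congʳ : ∀ {a a'} p → a ≈ a' → a · p ≋ a' · p
  ·-congʳ {a} {a'} p a≈a' = coeffwise λ n →
    trans (coeff-· a p n) (trans (*-congʳ a≈a') (sym (coeff-· a' p n)))

  ·-congˡ : ∀ a {p q} → p ≋ q → a · p ≋ a · q
  ·-congˡ a {p} {q} p≋q = coeffwise λ n →
    trans (coeff-· a p n) (trans (*-congˡ (at p≋q n)) (sym (coeff-· a q n)))

  ⊗-congˡ : ∀ p {q q'} → q ≋ q' → p ⊗ q ≋ p ⊗ q'
  ⊗-congˡ []      q≋q' = ≋-refl
  ⊗-congˡ (a ∷ p) q≋q' = ⊕-cong (·-congˡ a q≋q') (∷-cong refl (⊗-congˡ p q≋q'))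

  ⊗-zeroʳ : ∀ p → p ⊗ [] ≋ []
  ⊗-zeroʳ []      = ≋-refl
  ⊗-zeroʳ (a ∷ p) = coeffwise λ n → trans (coeff-∷⊗ a p [] n)
    (trans (+-cong (zeroʳ a) (at (∷-zero (⊗-zeroʳ p)) n)) (+-identityˡ 0#))

  ⊗-identityʳ : ∀ p → p ⊗ (1# ∷ []) ≋ p
  ⊗-identityʳ []      = ≋-refl
  ⊗-identityʳ (a ∷ p) = coeffwise λ
    { zero    → trans (coeff-∷⊗ a p (1# ∷ []) zero) (trans (+-identityʳ _) (*-identityʳ a))
    ; (suc n) → trans (coeff-∷⊗ a p (1# ∷ []) (suc n))
                  (trans (+-cong (zeroʳ a) (at (⊗-identityʳ p) n)) (+-identityˡ _)) }

  ⊗-zeroˡ : ∀ p q → p ≋ [] → p ⊗ q ≋ []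
  ⊗-zeroˡ []      q p≋0 = ≋-refl
  ⊗-zeroˡ (a ∷ p) q p≋0 = coeffwise λ n → trans (coeff-∷⊗ a p q n)
    (trans (+-cong (trans (*-congʳ (at p≋0 zero)) (zeroˡ _))
                   (at (∷-zero (⊗-zeroˡ p q (coeffwise λ m → at p≋0 (suc m)))) n))
           (+-identityˡ 0#))

  -- Needed because coefficient lists of equal polynomials may differ in
  -- length (trailing zeros).
  ⊗-congʳ : ∀ {p p'} q → p ≋ p' → p ⊗ q ≋ p' ⊗ q
  ⊗-congʳ {[]}    {p'}      q p≋p' = ≋-sym (⊗-zeroˡ p' q (≋-sym p≋p'))
  ⊗-congʳ {a ∷ p} {[]}      q p≋p' = ⊗-zeroˡ (a ∷ p) q p≋p'
  ⊗-congʳ {a ∷ p} {a' ∷ p'} q p≋p' =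
    ⊕-cong (·-congʳ q (at p≋p' zero))
           (∷-cong refl (⊗-congʳ {p} {p'} q (coeffwise λ n → at p≋p' (suc n))))

  ⊗-distribʳ : ∀ p q r → (p ⊕ q) ⊗ r ≋ p ⊗ r ⊕ q ⊗ r
  ⊗-distribʳ []      q       r = ≋-refl
  ⊗-distribʳ (a ∷ p) []      r = ≋-sym (⊕-identityʳ ((a ∷ p) ⊗ r))
  ⊗-distribʳ (a ∷ p) (b ∷ q) r = coeffwise λ n → begin
    (((a + b) ∷ (p ⊕ q)) ⊗ r) [ n ]
      ≈⟨ coeff-∷⊗ (a + b) (p ⊕ q) r n ⟩
    (a + b) * r [ n ] + (0# ∷ (p ⊕ q) ⊗ r) [ n ]
      ≈⟨ +-cong (distribʳ _ a b) (at (≋-trans (∷-cong refl (⊗-distribʳ p q r)) (∷-⊕ (p ⊗ r) (q ⊗ r))) n) ⟩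
    (a * r [ n ] + b * r [ n ]) + ((0# ∷ p ⊗ r) ⊕ (0# ∷ q ⊗ r)) [ n ]
      ≈⟨ +-congˡ (coeff-⊕ (0# ∷ p ⊗ r) (0# ∷ q ⊗ r) n) ⟩
    (a * r [ n ] + b * r [ n ]) + ((0# ∷ p ⊗ r) [ n ] + (0# ∷ q ⊗ r) [ n ])
      ≈⟨ interchange _ _ _ _ ⟩
    (a * r [ n ] + (0# ∷ p ⊗ r) [ n ]) + (b * r [ n ] + (0# ∷ q ⊗ r) [ n ])
      ≈⟨ +-cong (coeff-∷⊗ a p r n) (coeff-∷⊗ b q r n) ⟨
    ((a ∷ p) ⊗ r) [ n ] + ((b ∷ q) ⊗ r) [ n ]
      ≈⟨ coeff-⊕ ((a ∷ p) ⊗ r) ((b ∷ q) ⊗ r) n ⟨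
    ((a ∷ p) ⊗ r ⊕ (b ∷ q) ⊗ r) [ n ] ∎
    where open SetoidReasoning setoid

  X-⊗ : ∀ q → X ⊗ q ≋ 0# ∷ q
  X-⊗ q = coeffwise λ n → begin
    (X ⊗ q) [ n ]                                ≈⟨ coeff-∷⊗ 0# (1# ∷ []) q n ⟩
    0# * q [ n ] + (0# ∷ (1# ∷ []) ⊗ q) [ n ]    ≈⟨ +-congʳ (zeroˡ _) ⟩
    0# + (0# ∷ (1# ∷ []) ⊗ q) [ n ]              ≈⟨ +-identityˡ _ ⟩
    (0# ∷ (1# ∷ []) ⊗ q) [ n ]                   ≈⟨ at (∷-cong refl one-⊗) n ⟩
    (0# ∷ q) [ n ]                               ∎
    where
    open SetoidReasoning setoid
    one-⊗ : (1# ∷ []) ⊗ q ≋ q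
    one-⊗ = coeffwise λ m → trans (coeff-∷⊗ 1# [] q m)
      (trans (+-cong (*-identityˡ _) (at (∷-zero ≋-refl) m)) (+-identityʳ _))

-- Horner's rule
-- f = f₀ + X·f' turns f ∘ g into f₀ + X·(f' ∘ g) + b·(f' ∘ g); when f' is
-- itself fixed by composition with g this is f + b·f'.
module Translation {c ℓ : Level} (R : CommutativeRing c ℓ) (b g : Poly R)
                   (g≋X⊕b : PolynomialArithmetic._≋_ R g (PolynomialArithmetic._⊕_ R (T R) b)) where
  open CommutativeRing R using (_+_; 0#; +-identityʳ)
  open PolynomialArithmetic R
  open SetoidReasoning ≋-setoid

  g-⊗ : ∀ q → g ⊗ q ≋ (0# ∷ q) ⊕ b ⊗ q
  g-⊗ q = begin
    g ⊗ q                ≈⟨ ⊗-congʳ q g≋X⊕b ⟩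
    (X ⊕ b) ⊗ q          ≈⟨ ⊗-distribʳ X b q ⟩
    X ⊗ q ⊕ b ⊗ q        ≈⟨ ⊕-congʳ (b ⊗ q) (X-⊗ q) ⟩
    (0# ∷ q) ⊕ b ⊗ q     ∎

  ∘-horner : ∀ f → tail f ∘ₚ g ≋ tail f → f ∘ₚ g ≋ f ⊕ b ⊗ tail f
  ∘-horner []      _     = ≋-sym (⊗-zeroʳ b)
  ∘-horner (a ∷ q) fixed = begin
    (a ∷ []) ⊕ g ⊗ (q ∘ₚ g)              ≈⟨ ⊕-congˡ (a ∷ []) (⊗-congˡ g fixed) ⟩
    (a ∷ []) ⊕ g ⊗ q                     ≈⟨ ⊕-congˡ (a ∷ []) (g-⊗ q) ⟩
    (a ∷ []) ⊕ ((0# ∷ q) ⊕ b ⊗ q)        ≈⟨ ⊕-assoc (a ∷ []) (0# ∷ q) (b ⊗ q) ⟨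
    ((a + 0#) ∷ q) ⊕ b ⊗ q               ≈⟨ ⊕-congʳ (b ⊗ q) (∷-congˡ q (+-identityʳ a)) ⟩
    (a ∷ q) ⊕ b ⊗ q                      ∎

module SquareZeroIdeal {c ℓ ℓ' : Level} (R : CommutativeRing c ℓ) (I : Ideal R ℓ')
                       (sq : SquareZero R I) where
  open CommutativeRing R hiding (zero)
  open Ideal I
  open RingProperties ring using (-0#≈0#; //-rightDividesˡ; x[y-z]≈xy-xz; x∙y⁻¹≈ε⇒x≈y)
  open CommutativeSemigroupProperties +-commutativeSemigroup using (x∙yz≈y∙xz)
  open PolynomialArithmetic R

  x-0≈x : ∀ x → x - 0# ≈ x
  x-0≈x x = trans (+-congˡ -0#≈0#) (+-identityʳ x)

  -- Coefficientwise congruence modulo I; u ≡I [] means u ∈ I[X].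
  infix 4 _≡I_
  record _≡I_ (u v : P) : Set ℓ' where
    constructor coeffwise-mod
    field at-mod : ∀ n → member (u [ n ] - v [ n ])
  open _≡I_

  tail-≡I : ∀ {u v} → u ≡I v → tail u ≡I tail v
  tail-≡I {u} {v} u≡v = coeffwise-mod λ n →
    subst₂ (λ x y → member (x - y)) (≡.sym (coeff-tail u n)) (≡.sym (coeff-tail v n))
           (at-mod u≡v (suc n))

  annihilate-scalar : ∀ {a x y} → member a → member (x - y) → a * x ≈ a * y
  annihilate-scalar {a} {x} {y} a∈I x-y∈I =
    x∙y⁻¹≈ε⇒x≈y _ _ (trans (sym (x[y-z]≈xy-xz a x y)) (sq a (x - y) a∈I x-y∈I))

  annihilate : ∀ {q u v} → q ≡I [] → u ≡I v → q ⊗ u ≋ q ⊗ v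
  annihilate {[]}    q∈I u≡v = ≋-refl
  annihilate {a ∷ q} {u} {v} q∈I u≡v =
    ⊕-cong scalar (∷-cong refl (annihilate {q} (tail-≡I q∈I) u≡v))
    where
    a∈I : member a
    a∈I = member-resp (x-0≈x a) (at-mod q∈I zero)
    scalar : a · u ≋ a · v
    scalar = coeffwise λ n → trans (coeff-· a u n)
      (trans (annihilate-scalar a∈I (at-mod u≡v n)) (sym (coeff-· a v n)))

  square-zero : ∀ {p q} → p ≡I [] → q ≡I [] → p ⊗ q ≋ []
  square-zero {p} p∈I q∈I = ≋-trans (annihilate p∈I q∈I) (⊗-zeroʳ p)

  ⊖-∈I : ∀ {u v} → u ≡I v → u ⊖ v ≡I []
  ⊖-∈I {u} {v} u≡v = coeffwise-mod λ n →
    member-resp (sym (trans (x-0≈x _) (coeff-⊖ u v n))) (at-mod u≡v n)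

  ⊖-decompose : ∀ u v → u ≋ v ⊕ (u ⊖ v)
  ⊖-decompose u v = coeffwise λ n → sym
    (trans (coeff-⊕ v (u ⊖ v) n)
      (trans (+-congˡ (coeff-⊖ u v n)) (trans (+-comm _ _) (//-rightDividesˡ _ _))))

  module _ (g : P) (g≡X : g ≡I X) where
    open Translation R (g ⊖ X) g (⊖-decompose g X)
    open SetoidReasoning ≋-setoid

    ∘-fixed : ∀ q → tail q ≡I [] → q ∘ₚ g ≋ q
    ∘-fixed []      _   = ≋-refl
    ∘-fixed (a ∷ q) q∈I = begin
      (a ∷ q) ∘ₚ g              ≈⟨ ∘-horner (a ∷ q) (∘-fixed q (tail-≡I q∈I)) ⟩
      (a ∷ q) ⊕ (g ⊖ X) ⊗ q     ≈⟨ ⊕-congˡ (a ∷ q) (square-zero (⊖-∈I g≡X) q∈I) ⟩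
      (a ∷ q) ⊕ []              ≈⟨ ⊕-identityʳ (a ∷ q) ⟩
      a ∷ q                     ∎

    ∘-kernel : ∀ f → f ≡I X → f ∘ₚ g ≋ f ⊕ (g ⊖ X)
    ∘-kernel f f≡X = begin
      f ∘ₚ g                     ≈⟨ ∘-horner f (∘-fixed (tail f) (tail-≡I tail-f≡1)) ⟩
      f ⊕ (g ⊖ X) ⊗ tail f       ≈⟨ ⊕-congˡ f (annihilate (⊖-∈I g≡X) tail-f≡1) ⟩
      f ⊕ (g ⊖ X) ⊗ (1# ∷ [])    ≈⟨ ⊕-congˡ f (⊗-identityʳ (g ⊖ X)) ⟩
      f ⊕ (g ⊖ X)                ∎
      where
      tail-f≡1 : tail f ≡I 1# ∷ []
      tail-f≡1 = tail-≡I f≡X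

  kernel-commutative : ∀ f g → f ≡I X → g ≡I X → f ∘ₚ g ≋ g ∘ₚ f
  kernel-commutative f g f≡X g≡X = begin
    f ∘ₚ g          ≈⟨ ∘-kernel g g≡X f f≡X ⟩
    f ⊕ (g ⊖ X)     ≈⟨ symmetric ⟩
    g ⊕ (f ⊖ X)     ≈⟨ ∘-kernel f f≡X g g≡X ⟨
    g ∘ₚ f          ∎
    where
    open SetoidReasoning ≋-setoid
    symmetric : f ⊕ (g ⊖ X) ≋ g ⊕ (f ⊖ X)
    symmetric = coeffwise λ n →
      trans (coeff-⊕ f (g ⊖ X) n)
        (trans (+-congˡ (coeff-⊖ g X n))
          (trans (x∙yz≈y∙xz _ _ _)
            (sym (trans (coeff-⊕ g (f ⊖ X) n) (+-congˡ (coeff-⊖ f X n))))))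

  coeff-quotient : ∀ f n → coeff (R / I) f n ≡ f [ n ]
  coeff-quotient []      n       = ≡.refl
  coeff-quotient (a ∷ f) zero    = ≡.refl
  coeff-quotient (a ∷ f) (suc n) = coeff-quotient f n

  kernel⇒≡X : ∀ f → InKernel R I f → f ≡I X
  kernel⇒≡X f f∈ker = coeffwise-mod λ n →
    subst₂ (λ x y → member (x - y)) (coeff-quotient f n) (coeff-quotient X n) (proj₂ f∈ker n)

lemma4p6 : ∀ {c ℓ ℓ' : Level} (R : CommutativeRing c ℓ) (I : Ideal R ℓ')
    → SquareZero R I
    → ∀ f g → InKernel R I f → InKernel R I g
    → _≈P_ R (_∘P_ R f g) (_∘P_ R g f)
lemma4p6 R I sq f g f∈ker g∈ker =
  PolynomialArithmetic.at (kernel-commutative f g (kernel⇒≡X f f∈ker) (kernel⇒≡X g g∈ker))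
  where open SquareZeroIdeal R I sq
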